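{- Let $c$ be a Coxeter element of the group $\widetilde S^{\,s}$ of affine signed permutations (type $\widetilde C_{n-1}$), represented as a signing of $\{1,\ldots,n-1\}$. If $a_1<a_2<\cdots<a_{n-1}$ are the elements of the signing, then $$c=(\!(\cdots\ a_1\ a_2\ \cdots\ a_{n-1}\ \ a_1+2n\ \cdots)\!).$$
   Context: Fix an integer $n\ge2$. The group of affine signed permutations consists of the bijections $\pi:\mathbb Z\to\mathbb Z$ with $\pi(i+2n)=\pi(i)+2n$ and $\pi(-i)=-\pi(i)$ for all $i$ (these fix all multiples of $n$); it is a Coxeter group of type $\widetilde C_{n-1}$ with simple reflections $s_0=(-1\ \ 1)_{2n}$, $s_i=(\!(i\ \ i+1)\!)_{2n}$ for $1\le i\le n-2$, and $s_{n-1}=(n-1\ \ n+1)_{2n}$. Here $(a_1\ \cdots\ a_k)_{2n}=\prod_{\ell\in\mathbb Z}(a_1+2\ell n\ \cdots\ a_k+2\ell n)$, $(\!(a_1\ \cdots\ a_k)\!)_{2n}$ denotes $(a_1\ \cdots\ a_k)_{2n}(-a_1\ \cdots\ -a_k)_{2n}$, and $(\!(\cdots\ a_1\ \cdots\ a_\ell\ a_1+2qn\ \cdots)\!)$ denotes the product of the infinite cycle $(\cdots\ a_1\ \cdots\ a_\ell\ a_1+2qn\ \cdots)$ (each entry of the bi-infinite sequence $\ldots,a_1,\ldots,a_\ell,a_1+2qn,\ldots,a_\ell+2qn,a_1+4qn,\ldots$ sent to the next) with its negative $(\cdots\ -a_1\ \cdots\ -a_\ell\ -a_1-2qn\ \cdots)$.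 A Coxeter element $c$ (product of $s_0,\ldots,s_{n-1}$ in some order) is represented by its signing: for each $i=1,\ldots,n-1$ the signing contains $i$ if $s_{i-1}$ precedes $s_i$ in $c$ and contains $-i$ if $s_i$ precedes $s_{i-1}$. -}

module Defs where

open import Data.Nat as ℕ using (ℕ; zero; suc; _∸_; _<ᵇ_; _≡ᵇ_)
open import Data.Integer as ℤ using (ℤ; +_; -_; _+_; _-_; _*_)
open import Data.Integer.DivMod using (_/ℕ_; _%ℕ_)
open import Data.Fin using (Fin; toℕ)
open import Data.List using (List; []; _∷_; map; upTo; foldr)
open import Data.Bool using (Bool; true; false; if_then_else_)
open import Function using (_∘_; id)

-- Permutations of ℤ are represented as functions ℤ → ℤ.
-- Products are composed as functions: (f · g) x = f (g x)
-- (the rightmost factor acts first).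

-- Generic periodic cycle with period P and wrap-around shift w:
-- for as = a₁ … a_k it sends a_j + mP ↦ a_{j+1} + mP  (j < k)
-- and a_k + mP ↦ a₁ + w + mP (m ∈ ℤ); integers not ≡ any a_j (mod P)
-- are fixed.  (If x ≡ several a_j, the first is used; in all uses
-- below the entries are pairwise distinct mod P.)
--   * w = 0   : the finite cycle  (a₁ ⋯ a_k)_P
--   * w = qP  : the infinite cycle (⋯ a₁ ⋯ a_k a₁+qP ⋯)
private
  next : ℤ → List ℤ → ℤ
  next a₁w []      = a₁w
  next a₁w (b ∷ _) = b

  go : ℕ → ℤ → List ℤ → ℤ → ℤ
  go p a₁w []         x = x
  go p a₁w (a ∷ rest) x =
    if ((x - a) %ℕ suc p) ≡ᵇ 0
    then next a₁w rest + ((x - a) /ℕ suc p) * + suc p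
    else go p a₁w rest x

cycleP : ℕ → ℤ → List ℤ → ℤ → ℤ
cycleP zero    w as       x = x
cycleP (suc p) w []       x = x
cycleP (suc p) w (a ∷ as) x = go p (a + w) (a ∷ as) x

cyc : ℕ → List ℤ → ℤ → ℤ
cyc P as = cycleP P (+ 0) as

dcyc : ℕ → List ℤ → ℤ → ℤ
dcyc P as = cyc P as ∘ cyc P (map -_ as)

-- ((⋯ a₁ ⋯ a_ℓ a₁+qP ⋯))  =  (⋯ a₁ ⋯ a_ℓ a₁+qP ⋯)(⋯ -a₁ ⋯ -a_ℓ -a₁-qP ⋯)
icyc : ℕ → ℤ → List ℤ → ℤ → ℤ
icyc P q as = cycleP P (q * + P) as ∘ cycleP P (- (q * + P)) (map -_ as)

sref : (n : ℕ) → Fin n → ℤ → ℤ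
sref n i =
  if toℕ i ≡ᵇ 0 then cyc (2 ℕ.* n) (- + 1 ∷ + 1 ∷ [])
  else if toℕ i ≡ᵇ (n ∸ 1) then cyc (2 ℕ.* n) (+ (n ∸ 1) ∷ + (n ℕ.+ 1) ∷ [])
  else dcyc (2 ℕ.* n) (+ toℕ i ∷ + (suc (toℕ i)) ∷ [])

prodS : (n : ℕ) → List (Fin n) → ℤ → ℤ
prodS n = foldr (λ i f → sref n i ∘ f) id

-- Position (0-based) of the first occurrence of j in the word
-- (length of the word if absent).
pos : {n : ℕ} → List (Fin n) → ℕ → ℕ
pos []      j = 0
pos (i ∷ w) j = if toℕ i ≡ᵇ j then 0 else suc (pos w j)

signing : (n : ℕ) → List (Fin n) → List ℤ
signing n w = map sgn (upTo (n ∸ 1))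
  where
  sgn : ℕ → ℤ
  sgn k = if pos w k <ᵇ pos w (suc k) then + suc k else - (+ suc k)

{-# OPTIONS --safe #-}
module Submission where

-- Write val t (t ∈ ℤ) for the integers not divisible by n in increasing order. The generator s_i
-- exchanges val t and val (t + 1), together with their translates by 2n and their negatives, exactly
-- when i is the label of the step from t to t + 1, and it fixes all other integers. Reading
-- c = s_{w₁} ⋯ s_{w_k} from the right, a point keeps climbing as long as the letter of each new step
-- lies further left in w than the letter of the previous one. Hence c sends a point whose up-letter
-- comes after its down-letter in w (a rising point) to the next rising point, and every other point
-- down to the next falling one. The rising points of one period are the elements a₁ < ⋯ < a_{n-1} of
-- the signing and the falling points are their negatives, which is the cycle structure of
-- ((⋯ a₁ ⋯ a_{n-1} a₁+2n ⋯)).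

open import Defs
open import Data.Bool using (true; false; T; if_then_else_)
open import Data.Empty using (⊥; ⊥-elim)
open import Data.Fin as Fin using (Fin; toℕ)
import Data.Fin.Properties as Finₚ
open import Data.Integer using (ℤ; +_; -[1+_]; _+_; _-_; _*_; -_; _<_; _≤_; -<-; -<+; +<+; -≤+; +≤+)
open import Data.Integer.DivMod using (_/ℕ_; _%ℕ_; a≡a%ℕn+[a/ℕn]*n; n%ℕd<d)
import Data.Integer.Properties as ℤₚ
open import Data.Integer.Tactic.RingSolver using (solve-∀)
open import Data.List using (List; []; _∷_; _++_; map; foldr; take; drop; length; allFin)
import Data.List.Properties as Listₚ
open import Data.List.Membership.Propositional using (_∈_)
open import Data.List.Membership.Propositional.Properties
  using (∈-map⁻; ∈-map⁺; ∈-upTo⁺; ∈-upTo⁻; ∈-∃++; ∈-++⁻; ∈-++⁺ˡ; ∈-++⁺ʳ; ∈-allFin)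
open import Data.List.Relation.Binary.Permutation.Propositional using (_↭_; ↭-sym; ↭⇒↭ₛ)
open import Data.List.Relation.Binary.Permutation.Propositional.Properties using (∈-resp-↭)
import Data.List.Relation.Binary.Permutation.Setoid.Properties as ↭ₛ
open import Data.List.Relation.Unary.All as All using (All; []; _∷_)
import Data.List.Relation.Unary.All.Properties as Allₚ
open import Data.List.Relation.Unary.AllPairs using (AllPairs; []; _∷_)
open import Data.List.Relation.Unary.Any as Any using (Any; here; there)
open import Data.List.Relation.Unary.Linked using (Linked)
open import Data.List.Relation.Unary.Linked.Properties using (Linked⇒AllPairs)
open import Data.List.Relation.Unary.Unique.Propositional using (Unique)
import Data.List.Relation.Unary.Unique.Propositional.Properties as Uniqueₚ
open import Data.Nat as ℕ using (ℕ; zero; suc; z≤n; s≤s; _≡ᵇ_; _<ᵇ_; _∸_)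
import Data.Nat.Properties as ℕₚ
import Data.Nat.Tactic.RingSolver as ℕ-Solver
open import Data.Product using (∃; _×_; _,_; proj₁; proj₂)
open import Data.Sum using (_⊎_; inj₁; inj₂; [_,_]′)
open import Function using (_∘_; id)
open import Relation.Binary.Definitions using (tri<; tri≈; tri>)
open import Relation.Binary.PropositionalEquality
open import Relation.Nullary using (¬_; yes; no)
open import Relation.Nullary.Decidable using (dec-true; dec-false)

if-true : ∀ {A : Set} {b} {t f : A} → b ≡ true → (if b then t else f) ≡ t
if-true refl = refl

if-false : ∀ {A : Set} {b} {t f : A} → b ≡ false → (if b then t else f) ≡ f
if-false refl = refl

multiple-between⇒0 : ∀ d P → - + P < d * + P → d * + P < + P → d ≡ + 0
multiple-between⇒0 (+ zero)  P _ _  = refl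
multiple-between⇒0 (+ suc m) P _ hi =
  ⊥-elim (ℕₚ.<⇒≱ (ℤₚ.drop‿+<+ (subst (_< + P) (sym (ℤₚ.pos-* (suc m) P)) hi)) (ℕₚ.m≤n*m P (suc m)))
multiple-between⇒0 -[1+ m ] P lo _ =
  ⊥-elim (ℕₚ.<⇒≱ (ℤₚ.drop‿+<+ (ℤₚ.neg-cancel-< (subst (- + P <_) lo≡ lo))) (ℕₚ.m≤n*m P (suc m)))
  where
  lo≡ : -[1+ m ] * + P ≡ - + (suc m ℕ.* P)
  lo≡ = trans (sym (ℤₚ.neg-distribˡ-* (+ suc m) (+ P))) (cong -_ (sym (ℤₚ.pos-* (suc m) P)))

shift-unique : ∀ P .{{_ : ℕ.NonZero P}} {u v q r} → u - v < + P → v - u < + P →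
  u + q * + P ≡ v + r * + P → u ≡ v × q ≡ r
shift-unique P {u} {v} {q} {r} u-v<P v-u<P e = u≡v , sym r≡q
  where
  diff : u - v ≡ (r - q) * + P
  diff = trans (shift u v q (+ P)) (trans (cong (_- (v + q * + P)) e) (cancel v r q (+ P)))
    where
    shift : ∀ u v q P → u - v ≡ (u + q * P) - (v + q * P)
    shift = solve-∀
    cancel : ∀ v r q P → (v + r * P) - (v + q * P) ≡ (r - q) * P
    cancel = solve-∀
  v-u≡ : - (v - u) ≡ u - v
  v-u≡ = flip u v
    where
    flip : ∀ u v → - (v - u) ≡ u - v
    flip = solve-∀
  r≡q : r ≡ q
  r≡q = ℤₚ.i-j≡0⇒i≡j r q (multiple-between⇒0 (r - q) P
          (subst (- + P <_) (trans v-u≡ diff) (ℤₚ.neg-mono-< v-u<P))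
          (subst (_< + P) diff u-v<P))
  u≡v : u ≡ v
  u≡v = ℤₚ.i-j≡0⇒i≡j u v (trans diff (cong (_* + P) (trans (cong (λ z → r - z) (sym r≡q)) (ℤₚ.+-inverseʳ r))))

divMod-unique : ∀ d .{{_ : ℕ.NonZero d}} {x j} q → j ℕ.< d → x ≡ + j + q * + d →
  x %ℕ d ≡ j × x /ℕ d ≡ q
divMod-unique d {x} {j} q j<d e with shift-unique d (below {b = j} (n%ℕd<d x d)) (below {b = x %ℕ d} j<d)
                                          (trans (sym (a≡a%ℕn+[a/ℕn]*n x d)) e)
  where
  below : ∀ {a b} → a ℕ.< d → + a - + b < + d
  below {a} {b} a<d = ℤₚ.≤-<-trans (ℤₚ.i-j≤i (+ a) (+ b)) (+<+ a<d)
... | r≡j , q≡q = ℤₚ.+-injective r≡j , q≡q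

%ℕ-periodic : ∀ d .{{_ : ℕ.NonZero d}} a q → (a + q * + d) %ℕ d ≡ a %ℕ d
%ℕ-periodic d a q = proj₁ (divMod-unique d (a /ℕ d + q) (n%ℕd<d a d)
  (trans (cong (_+ q * + d) (a≡a%ℕn+[a/ℕn]*n a d)) (regroup (+ (a %ℕ d)) (a /ℕ d) q (+ d))))
  where
  regroup : ∀ r e q D → r + e * D + q * D ≡ r + (e + q) * D
  regroup = solve-∀

headOr : {A : Set} → A → List A → A
headOr d []      = d
headOr _ (a ∷ _) = a

Swaps : (ℤ → ℤ) → ℤ → ℤ → Set
Swaps f u v = f u ≡ v × f v ≡ u

module PeriodicCycle (p : ℕ) where

  record Incongruent (x a : ℤ) : Set where
    constructor incongruent
    field apart : ∀ q → x ≢ a + q * + suc p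
  open Incongruent public

  congruent-residue : ∀ {x a} q → x ≡ a + q * + suc p →
    (x - a) %ℕ suc p ≡ 0 × (x - a) /ℕ suc p ≡ q
  congruent-residue {x} {a} q e = divMod-unique (suc p) q (s≤s z≤n) (trans (cong (_- a) e) (sub a q (+ suc p)))
    where
    sub : ∀ a q P → a + q * P - a ≡ + 0 + q * P
    sub = solve-∀

  congruent-test : ∀ {x a} q → x ≡ a + q * + suc p → ((x - a) %ℕ suc p ≡ᵇ 0) ≡ true
  congruent-test q e = cong (_≡ᵇ 0) (proj₁ (congruent-residue q e))

  incongruent-residue : ∀ {x a} → Incongruent x a → ((x - a) %ℕ suc p ≡ᵇ 0) ≡ false
  incongruent-residue {x} {a} inc = dec-false ((x - a) %ℕ suc p ℕ.≟ 0) λ r≡0 →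
    apart inc ((x - a) /ℕ suc p) (trans (add x a) (cong (λ y → a + y) (trans (a≡a%ℕn+[a/ℕn]*n (x - a) (suc p))
      (trans (cong (λ r → + r + (x - a) /ℕ suc p * + suc p) r≡0) (ℤₚ.+-identityˡ _)))))
    where
    add : ∀ x a → x ≡ a + (x - a)
    add = solve-∀

  -- The public counterpart of the private `next` used by cycleP.
  nextEntry : ℤ → List ℤ → ℤ
  nextEntry wrap []      = wrap
  nextEntry wrap (b ∷ _) = b

  cycleP-head : ∀ w a as {x} q → x ≡ a + q * + suc p →
    cycleP (suc p) w (a ∷ as) x ≡ nextEntry (a + w) as + q * + suc p
  cycleP-head w a []      q e =
    trans (if-true (congruent-test q e)) (cong (λ z → a + w + z * + suc p) (proj₂ (congruent-residue q e)))
  cycleP-head w a (b ∷ _) q e =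
    trans (if-true (congruent-test q e)) (cong (λ z → b + z * + suc p) (proj₂ (congruent-residue q e)))

  cycleP-skip : ∀ w a b as {x} → Incongruent x a → Incongruent x b →
    cycleP (suc p) w (a ∷ b ∷ as) x ≡ cycleP (suc p) w (a ∷ as) x
  cycleP-skip w a b as ia ib =
    trans (if-false (incongruent-residue ia)) (trans (if-false (incongruent-residue ib)) (sym (if-false (incongruent-residue ia))))

  cycleP-second : ∀ w a b as {x} q → Incongruent x a → x ≡ b + q * + suc p →
    cycleP (suc p) w (a ∷ b ∷ as) x ≡ nextEntry (a + w) as + q * + suc p
  cycleP-second w a b []      q ia e = trans (if-false (incongruent-residue ia))
    (trans (if-true (congruent-test q e)) (cong (λ z → a + w + z * + suc p) (proj₂ (congruent-residue q e))))
  cycleP-second w a b (c ∷ _) q ia e = trans (if-false (incongruent-residue ia))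
    (trans (if-true (congruent-test q e)) (cong (λ z → c + z * + suc p) (proj₂ (congruent-residue q e))))

  cycleP-fixes : ∀ w as {x} → All (Incongruent x) as → cycleP (suc p) w as x ≡ x
  cycleP-fixes w []           []              = refl
  cycleP-fixes w (a ∷ [])     (ia ∷ [])       = if-false (incongruent-residue ia)
  cycleP-fixes w (a ∷ b ∷ as) (ia ∷ ib ∷ ias) =
    trans (cycleP-skip w a b as ia ib) (cycleP-fixes w (a ∷ as) (ia ∷ ias))

  cycleP-hit : ∀ w pre b post {x} q → All (Incongruent x) pre → x ≡ b + q * + suc p →
    cycleP (suc p) w (pre ++ b ∷ post) x ≡ nextEntry (headOr b pre + w) post + q * + suc p
  cycleP-hit w []        b post q []         e = cycleP-head w b post q e
  cycleP-hit w (a ∷ pre) b post q (ia ∷ ias) e = after-head pre ias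
    where
    after-head : ∀ pre → All (Incongruent _) pre →
      cycleP (suc p) w (a ∷ pre ++ b ∷ post) _ ≡ nextEntry (a + w) post + q * + suc p
    after-head []        []         = cycleP-second w a b post q ia e
    after-head (c ∷ pre) (ic ∷ ias) = trans (cycleP-skip w a c (pre ++ b ∷ post) ia ic) (after-head pre ias)

  congruent? : ∀ x a → Incongruent x a ⊎ ∃ λ q → x ≡ a + q * + suc p
  congruent? x a with x %ℕ suc p ℕ.≟ a %ℕ suc p
  ... | no  x≢a = inj₁ (incongruent λ q e → x≢a (trans (cong (_%ℕ suc p) e) (%ℕ-periodic (suc p) a q)))
  ... | yes x≡a = inj₂ (x /ℕ suc p - a /ℕ suc p , trans (a≡a%ℕn+[a/ℕn]*n x (suc p))
        (trans (cong (λ r → + r + x /ℕ suc p * + suc p) x≡a)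
          (trans (regroup (+ (a %ℕ suc p)) (a /ℕ suc p) (x /ℕ suc p) (+ suc p))
            (cong (_+ (x /ℕ suc p - a /ℕ suc p) * + suc p) (sym (a≡a%ℕn+[a/ℕn]*n a (suc p)))))))
    where
    regroup : ∀ r d e P → r + e * P ≡ (r + d * P) + (e - d) * P
    regroup = solve-∀

  neg-shift : ∀ a q → - (a + q * + suc p) ≡ - a + (- q) * + suc p
  neg-shift a q = distrib a q (+ suc p)
    where
    distrib : ∀ a q P → - (a + q * P) ≡ - a + (- q) * P
    distrib = solve-∀

  incongruent-neg : ∀ {x a} → Incongruent x a → Incongruent (- x) (- a)
  incongruent-neg {x} {a} inc = incongruent λ q e →
    apart inc (- q) (trans (sym (ℤₚ.neg-involutive x))
      (trans (cong -_ e) (trans (neg-shift (- a) q) (cong (_+ _) (ℤₚ.neg-involutive a)))))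

  nextEntry-neg : ∀ a w as q →
    nextEntry (- a + - w) (map -_ as) + (- q) * + suc p ≡ - (nextEntry (a + w) as + q * + suc p)
  nextEntry-neg a w as q = trans (cong (λ A → nextEntry A (map -_ as) + (- q) * + suc p) (sym (ℤₚ.neg-distrib-+ a w)))
                                 (negate (a + w) as)
    where
    negate : ∀ A as → nextEntry (- A) (map -_ as) + (- q) * + suc p ≡ - (nextEntry A as + q * + suc p)
    negate A []      = sym (neg-shift A q)
    negate A (b ∷ _) = sym (neg-shift b q)

  cycleP-neg : ∀ w as x → cycleP (suc p) (- w) (map -_ as) (- x) ≡ - cycleP (suc p) w as x
  cycleP-neg w []       x = refl
  cycleP-neg w (a ∷ as) x with congruent? x a
  ... | inj₂ (q , e) = trans (cycleP-head (- w) (- a) (map -_ as) (- q) (trans (cong -_ e) (neg-shift a q)))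
        (trans (nextEntry-neg a w as q) (cong -_ (sym (cycleP-head w a as q e))))
  ... | inj₁ ia = after-head as
    where
    after-head : ∀ as → cycleP (suc p) (- w) (- a ∷ map -_ as) (- x) ≡ - cycleP (suc p) w (a ∷ as) x
    after-head [] = trans (cycleP-fixes (- w) (- a ∷ []) (incongruent-neg ia ∷ []))
                          (cong -_ (sym (cycleP-fixes w (a ∷ []) (ia ∷ []))))
    after-head (b ∷ as) with congruent? x b
    ... | inj₁ ib = trans (cycleP-skip (- w) (- a) (- b) (map -_ as) (incongruent-neg ia) (incongruent-neg ib))
                    (trans (after-head as) (cong -_ (sym (cycleP-skip w a b as ia ib))))
    ... | inj₂ (q , e) =
      trans (cycleP-second (- w) (- a) (- b) (map -_ as) (- q) (incongruent-neg ia) (trans (cong -_ e) (neg-shift b q)))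
        (trans (nextEntry-neg a w as q) (cong -_ (sym (cycleP-second w a b as q ia e))))

  transposition-swaps : ∀ a b m → Incongruent (b + m * + suc p) a →
    Swaps (cycleP (suc p) (+ 0) (a ∷ b ∷ [])) (a + m * + suc p) (b + m * + suc p)
  transposition-swaps a b m b≢a =
    cycleP-head (+ 0) a (b ∷ []) m refl ,
    trans (cycleP-second (+ 0) a b [] m b≢a refl) (cong (_+ m * + suc p) (ℤₚ.+-identityʳ a))

act : ∀ {n} {A : Set} → (Fin n → A → A) → List (Fin n) → A → A
act s = foldr (λ i f → s i ∘ f) id

act-++ : ∀ {n} {A : Set} (s : Fin n → A → A) u v x → act s (u ++ v) x ≡ act s u (act s v x)
act-++ s []      v x = refl
act-++ s (i ∷ u) v x = cong (s i) (act-++ s u v x)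

module _ {n : ℕ} where

  Before : List (Fin n) → ℕ → ℕ → Set
  Before w l l′ = pos w l ℕ.< pos w l′

  Avoids : ℕ → List (Fin n) → Set
  Avoids l = All (λ i → toℕ i ≢ l)

  pos≤length : ∀ (u : List (Fin n)) l → pos u l ℕ.≤ length u
  pos≤length []      l = z≤n
  pos≤length (i ∷ u) l with toℕ i ≡ᵇ l
  ... | true  = z≤n
  ... | false = s≤s (pos≤length u l)

  take-pos-avoids : ∀ (u : List (Fin n)) l t → t ℕ.≤ pos u l → Avoids l (take t u)
  take-pos-avoids u       l zero    _ = []
  take-pos-avoids []      l (suc t) _ = []
  take-pos-avoids (i ∷ u) l (suc t) h with toℕ i ≡ᵇ l in e
  ... | false = (λ i≡l → subst T e (ℕₚ.≡⇒≡ᵇ _ _ i≡l)) ∷ take-pos-avoids u l t (ℕₚ.≤-pred h)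

  drop-pos-avoids : ∀ {u : List (Fin n)} l t → Unique u → pos u l ℕ.< t → Avoids l (drop t u)
  drop-pos-avoids {[]}    l zero    _          _ = []
  drop-pos-avoids {[]}    l (suc t) _          _ = []
  drop-pos-avoids {i ∷ u} l (suc t) (i∉u ∷ !u) h with toℕ i ≡ᵇ l in e
  ... | true  = Allₚ.drop⁺ t (All.map (λ i≢j j≡l → i≢j (Finₚ.toℕ-injective (trans i≡l (sym j≡l)))) i∉u)
    where
    i≡l = ℕₚ.≡ᵇ⇒≡ (toℕ i) l (subst T (sym e) _)
  ... | false = drop-pos-avoids l t !u (ℕₚ.≤-pred h)

  pos-split : ∀ (u : List (Fin n)) l → pos u l ℕ.< length u →
    ∃ λ i → toℕ i ≡ l × u ≡ take (pos u l) u ++ i ∷ drop (suc (pos u l)) u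
  pos-split (i ∷ u) l h with toℕ i ≡ᵇ l in e
  ... | true  = i , ℕₚ.≡ᵇ⇒≡ (toℕ i) l (subst T (sym e) _) , refl
  ... | false with pos-split u l (ℕₚ.≤-pred h)
  ... | j , j≡l , split = j , j≡l , cong (i ∷_) split

  pos-take : ∀ (u : List (Fin n)) l t → pos u l ℕ.< t → pos (take t u) l ≡ pos u l
  pos-take []      l (suc t) h = refl
  pos-take (i ∷ u) l (suc t) h with toℕ i ≡ᵇ l
  ... | true  = refl
  ... | false = cong suc (pos-take u l t (ℕₚ.≤-pred h))

  pos-take-< : ∀ (u : List (Fin n)) l t → pos u l ℕ.< t → pos u l ℕ.< length u →
    pos (take t u) l ℕ.< length (take t u)
  pos-take-< (i ∷ u) l (suc t) h₁ h₂ with toℕ i ≡ᵇ l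
  ... | true  = s≤s z≤n
  ... | false = s≤s (pos-take-< u l t (ℕₚ.≤-pred h₁) (ℕₚ.≤-pred h₂))

  pos-< : ∀ (u : List (Fin n)) l → Any (λ i → toℕ i ≡ l) u → pos u l ℕ.< length u
  pos-< (i ∷ u) l i∈u with toℕ i ≡ᵇ l in e
  ... | true  = s≤s z≤n
  pos-< (i ∷ u) l (here  i≡l) | false = ⊥-elim (subst T e (ℕₚ.≡⇒≡ᵇ _ _ i≡l))
  pos-< (i ∷ u) l (there l∈u) | false = s≤s (pos-< u l l∈u)

  pos-injective : ∀ (u : List (Fin n)) l l′ → pos u l ℕ.< length u → pos u l ≡ pos u l′ → l ≡ l′
  pos-injective (i ∷ u) l l′ h e with toℕ i ≡ᵇ l in e₁ | toℕ i ≡ᵇ l′ in e₂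
  ... | true  | true  =
    trans (sym (ℕₚ.≡ᵇ⇒≡ (toℕ i) l (subst T (sym e₁) _))) (ℕₚ.≡ᵇ⇒≡ (toℕ i) l′ (subst T (sym e₂) _))
  ... | false | false = pos-injective u l l′ (ℕₚ.≤-pred h) (ℕₚ.suc-injective e)

module Climb {n : ℕ} {A X : Set} (s : Fin n → A → A) (val : X → A) (up : X → X) (lab labD : X → ℕ)
  (labD-up : ∀ x → labD (up x) ≡ lab x)
  (s-moves : ∀ i x → toℕ i ≡ lab x → s i (val x) ≡ val (up x))
  (s-fixes : ∀ i x → toℕ i ≢ lab x → toℕ i ≢ labD x → s i (val x) ≡ val x)
  where

  open ≡-Reasoning

  climb : ℕ → X → X
  climb zero    x = x
  climb (suc j) x = climb j (up x)

  Ascends Descends : List (Fin n) → X → Set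
  Ascends  w x = Before w (labD x) (lab x)
  Descends w x = Before w (lab x) (labD x)

  act-fixes : ∀ u x → Avoids (lab x) u → Avoids (labD x) u → act s u (val x) ≡ val x
  act-fixes []      x _           _             = refl
  act-fixes (i ∷ u) x (i≢l ∷ u≢l) (i≢l′ ∷ u≢l′) =
    trans (cong (s i) (act-fixes u x u≢l u≢l′)) (s-fixes i x i≢l i≢l′)

  act-step : ∀ u x → Unique u → pos u (lab x) ℕ.< length u → Avoids (labD x) (drop (suc (pos u (lab x))) u) →
    act s u (val x) ≡ act s (take (pos u (lab x)) u) (val (up x))
  act-step u x !u present after with pos-split u (lab x) present
  ... | i , i≡l , split = begin
    act s u (val x)                                    ≡⟨ cong (λ v → act s v (val x)) split ⟩
    act s (take p u ++ i ∷ drop (suc p) u) (val x)     ≡⟨ act-++ s (take p u) (i ∷ drop (suc p) u) (val x) ⟩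
    act s (take p u) (s i (act s (drop (suc p) u) (val x)))
      ≡⟨ cong (λ z → act s (take p u) (s i z)) (act-fixes _ x (drop-pos-avoids (lab x) (suc p) !u ℕₚ.≤-refl) after) ⟩
    act s (take p u) (s i (val x))                     ≡⟨ cong (act s (take p u)) (s-moves i x i≡l) ⟩
    act s (take p u) (val (up x))                      ∎
    where p = pos u (lab x)

  -- Once z has been reached through its down-letter, only the letters to the left of that letter remain.
  act-prefix-climbs : ∀ w → Unique w → ∀ k z → (∀ j → j ℕ.< k → Descends w (climb j z)) → Ascends w (climb k z) →
    act s (take (pos w (labD z)) w) (val z) ≡ val (climb k z)
  act-prefix-climbs w !w zero z _ asc =
    act-fixes _ z (take-pos-avoids w (lab z) _ (ℕₚ.<⇒≤ asc)) (take-pos-avoids w (labD z) _ ℕₚ.≤-refl)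
  act-prefix-climbs w !w (suc k) z desc asc = begin
    act s (take t w) (val z)
      ≡⟨ act-step (take t w) z (Uniqueₚ.take⁺ t !w)
           (pos-take-< w (lab z) t p<t (ℕₚ.<-≤-trans p<t (pos≤length w (labD z))))
           (Allₚ.drop⁺ (suc (pos (take t w) (lab z))) (take-pos-avoids w (labD z) t ℕₚ.≤-refl)) ⟩
    act s (take (pos (take t w) (lab z)) (take t w)) (val (up z))
      ≡⟨ cong (λ q → act s (take q (take t w)) (val (up z))) (pos-take w (lab z) t p<t) ⟩
    act s (take p (take t w)) (val (up z))
      ≡⟨ cong (λ v → act s v (val (up z)))
           (trans (Listₚ.take-take p t w) (cong (λ m → take m w) (ℕₚ.m≤n⇒m⊓n≡m (ℕₚ.<⇒≤ p<t)))) ⟩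
    act s (take p w) (val (up z))
      ≡⟨ cong (λ q → act s (take (pos w q) w) (val (up z))) (sym (labD-up z)) ⟩
    act s (take (pos w (labD (up z))) w) (val (up z))
      ≡⟨ act-prefix-climbs w !w k (up z) (λ j j<k → desc (suc j) (s≤s j<k)) asc ⟩
    val (climb k (up z)) ∎
    where
    t = pos w (labD z)
    p = pos w (lab z)
    p<t : p ℕ.< t
    p<t = desc 0 (s≤s z≤n)

  act-climbs : ∀ w → Unique w → ∀ k y → pos w (lab y) ℕ.< length w → Ascends w y →
    (∀ j → j ℕ.< k → Descends w (climb j (up y))) → Ascends w (climb k (up y)) →
    act s w (val y) ≡ val (climb k (up y))
  act-climbs w !w k y present asc desc asc′ = begin
    act s w (val y)
      ≡⟨ act-step w y !w present (drop-pos-avoids (labD y) _ !w (s≤s (ℕₚ.<⇒≤ asc))) ⟩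
    act s (take (pos w (lab y)) w) (val (up y))        ≡⟨ cong (λ q → act s (take (pos w q) w) (val (up y))) (sym (labD-up y)) ⟩
    act s (take (pos w (labD (up y))) w) (val (up y))  ≡⟨ act-prefix-climbs w !w k (up y) desc asc′ ⟩
    val (climb k (up y))                               ∎

-- minus c and plus c stand for the values -(c+1) and c+1; the generator s_(upLabel σ) moves value σ
-- to the next larger integer not divisible by n, and s_(downLabel σ) to the next smaller one.
data Signed : Set where
  minus plus : ℕ → Signed

value : Signed → ℤ
value (minus c) = -[1+ c ]
value (plus c)  = + suc c

upLabel downLabel : Signed → ℕ
upLabel   (minus c) = c
upLabel   (plus c)  = suc c
downLabel (minus c) = suc c
downLabel (plus c)  = c

value-injective : ∀ {σ τ} → value σ ≡ value τ → σ ≡ τ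
value-injective {minus c} {minus .c} refl = refl
value-injective {plus c}  {plus .c}  refl = refl

∘-swaps : ∀ f g {u v} → Swaps g u v → f u ≡ u → f v ≡ v → Swaps (f ∘ g) u v
∘-swaps f g (gu≡v , gv≡u) fu≡u fv≡v = trans (cong f gu≡v) fv≡v , trans (cong f gv≡u) fu≡u

swaps-∘ : ∀ f g {u v} → g u ≡ u → g v ≡ v → Swaps f u v → Swaps (f ∘ g) u v
swaps-∘ f g gu≡u gv≡v (fu≡v , fv≡u) = trans (cong f gu≡u) fu≡v , trans (cong f gv≡v) fv≡u

swaps-sym : ∀ f {u v} → Swaps f u v → Swaps f v u
swaps-sym f (fu≡v , fv≡u) = fv≡u , fu≡v

module AffineC (k : ℕ) where

  n : ℕ
  n = suc (suc k)

  open PeriodicCycle (ℕ.pred (2 ℕ.* n)) public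

  P : ℤ
  P = + (2 ℕ.* n)

  Valid : Signed → Set
  Valid (minus c) = c ℕ.≤ k
  Valid (plus c)  = c ℕ.≤ k

  P≡n+n : P ≡ + n + + n
  P≡n+n = cong +_ (cong (n ℕ.+_) (ℕₚ.+-identityʳ n))

  Centered : ℤ → Set
  Centered v = - + n < v × v ≤ + n

  value-centered : ∀ {σ} → Valid σ → Centered (value σ)
  value-centered {minus c} c≤k = -<- (s≤s c≤k) , -≤+
  value-centered {plus c}  c≤k = -<+ , +≤+ (s≤s (ℕₚ.m≤n⇒m≤1+n c≤k))

  centered-incongruent : ∀ {u v} m → Centered u → Centered v → u ≢ v → Incongruent (u + m * P) v
  centered-incongruent m (n<u , u≤n) (n<v , v≤n) u≢v =
    incongruent λ q e → u≢v (proj₁ (shift-unique (2 ℕ.* n) {q = m} {r = q} (gap u≤n n<v) (gap v≤n n<u) e))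
    where
    gap : ∀ {a b} → a ≤ + n → - + n < b → a - b < + (2 ℕ.* n)
    gap {a} {b} a≤n n<b = subst (λ Q → a - b < Q) (sym P≡n+n) (ℤₚ.+-mono-≤-< a≤n (ℤₚ.neg-mono-< n<b))

  data Kind (i : Fin n) : Set where
    first  : toℕ i ≡ 0 → Kind i
    last   : toℕ i ≡ suc k → Kind i
    middle : ∀ c → toℕ i ≡ suc c → c ℕ.< k → Kind i

  kind : ∀ i → Kind i
  kind i with toℕ i in e | Finₚ.toℕ<n i
  ... | zero  | _       = first e
  ... | suc c | s≤s c<n with c ℕ.<? k
  ...   | yes c<k = middle c e c<k
  ...   | no  c≮k = last (trans e (cong suc (ℕₚ.≤-antisym (ℕₚ.≤-pred c<n) (ℕₚ.≮⇒≥ c≮k))))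

  transposition : ℤ → ℤ → ℤ → ℤ
  transposition a b = cyc (2 ℕ.* n) (a ∷ b ∷ [])

  sref-first : ∀ {i} → toℕ i ≡ 0 → sref n i ≡ transposition -[1+ 0 ] (+ 1)
  sref-first e = if-true (cong (_≡ᵇ 0) e)

  sref-last : ∀ {i} → toℕ i ≡ suc k → sref n i ≡ transposition (+ suc k) (+ (n ℕ.+ 1))
  sref-last e = trans (if-false (cong (_≡ᵇ 0) e)) (if-true (trans (cong (_≡ᵇ suc k) e) (dec-true (suc k ℕ.≟ suc k) refl)))

  sref-middle : ∀ {i c} → toℕ i ≡ suc c → c ℕ.< k →
    sref n i ≡ transposition (+ suc c) (+ suc (suc c)) ∘ transposition -[1+ c ] -[1+ suc c ]
  sref-middle {c = c} e c<k = trans (if-false (cong (_≡ᵇ 0) e))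
    (trans (if-false (trans (cong (_≡ᵇ suc k) e) (dec-false (suc c ℕ.≟ suc k) (ℕₚ.<⇒≢ (s≤s c<k)))))
      (cong (λ j → dcyc (2 ℕ.* n) (+ j ∷ + suc j ∷ [])) e))

  moved : ∀ {i} → Kind i → List Signed
  moved (first _)      = minus 0 ∷ plus 0 ∷ []
  moved (last _)       = plus k ∷ minus k ∷ []
  moved (middle c _ _) = plus c ∷ plus (suc c) ∷ minus c ∷ minus (suc c) ∷ []

  Moves : Fin n → Signed → Set
  Moves i σ = Valid σ × (toℕ i ≡ upLabel σ ⊎ toℕ i ≡ downLabel σ)

  moved-moves : ∀ {i} (κ : Kind i) → All (Moves i) (moved κ)
  moved-moves (first e)          = (z≤n , inj₁ e) ∷ (z≤n , inj₂ e) ∷ []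
  moved-moves (last e)           = (ℕₚ.≤-refl , inj₁ e) ∷ (ℕₚ.≤-refl , inj₂ e) ∷ []
  moved-moves (middle c e c<k) =
    (ℕₚ.<⇒≤ c<k , inj₁ e) ∷ (c<k , inj₂ e) ∷ (ℕₚ.<⇒≤ c<k , inj₂ e) ∷ (c<k , inj₁ e) ∷ []

  n+1-shift : ∀ m → + (n ℕ.+ 1) + m * P ≡ -[1+ k ] + (m + + 1) * P
  n+1-shift m = subst (λ Q → + (n ℕ.+ 1) + m * Q ≡ - + suc k + (m + + 1) * Q)
             (trans (sym (ℤₚ.pos-+ (suc k) (n ℕ.+ 1))) (cong +_ (sum k)))
             (wrap (+ suc k) (+ (n ℕ.+ 1)) m)
    where
    wrap : ∀ a b m → b + m * (a + b) ≡ - a + (m + + 1) * (a + b)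
    wrap = solve-∀
    sum : ∀ k → suc k ℕ.+ (suc (suc k) ℕ.+ 1) ≡ 2 ℕ.* suc (suc k)
    sum = ℕ-Solver.solve-∀

  centered-apart : ∀ {v} m σ → Centered v → Valid σ → v ≢ value σ → Incongruent (v + m * P) (value σ)
  centered-apart m σ cv vσ = centered-incongruent m cv (value-centered {σ} vσ)

  points-apart : ∀ σ τ m → Valid σ → Valid τ → value σ ≢ value τ → Incongruent (value σ + m * P) (value τ)
  points-apart σ τ m vσ = centered-apart m τ (value-centered {σ} vσ)

  sref-fixes : ∀ {i} (κ : Kind i) {v} m → Centered v → All (λ σ → v ≢ value σ) (moved κ) →
    sref n i (v + m * P) ≡ v + m * P
  sref-fixes (first e) m cv (v≢₁ ∷ v≢₂ ∷ []) =
    trans (cong (λ f → f _) (sref-first e))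
      (cycleP-fixes (+ 0) _ (centered-apart m (minus 0) cv z≤n v≢₁ ∷ centered-apart m (plus 0) cv z≤n v≢₂ ∷ []))
  sref-fixes (last e) m cv (v≢₁ ∷ v≢₂ ∷ []) =
    trans (cong (λ f → f _) (sref-last e))
      (cycleP-fixes (+ 0) _ (centered-apart m (plus k) cv ℕₚ.≤-refl v≢₁ ∷ apart-n+1 ∷ []))
    where
    apart-n+1 = incongruent λ q e → apart (centered-apart m (minus k) cv ℕₚ.≤-refl v≢₂) (q + + 1) (trans e (n+1-shift q))
  sref-fixes (middle c e c<k) m cv (v≢₁ ∷ v≢₂ ∷ v≢₃ ∷ v≢₄ ∷ []) =
    trans (cong (λ f → f _) (sref-middle e c<k))
      (trans (cong (transposition (+ suc c) (+ suc (suc c)))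
               (cycleP-fixes (+ 0) _ ( centered-apart m (minus c) cv c≤k v≢₃
                                     ∷ centered-apart m (minus (suc c)) cv c<k v≢₄ ∷ [])))
        (cycleP-fixes (+ 0) _ ( centered-apart m (plus c) cv c≤k v≢₁
                              ∷ centered-apart m (plus (suc c)) cv c<k v≢₂ ∷ [])))
    where
    c≤k = ℕₚ.<⇒≤ c<k

  data Adjacent : Signed → ℤ → Signed → ℤ → Set where
    minus-step : ∀ {c m} → Adjacent (minus (suc c)) m (minus c) m
    zero-step  : ∀ {m} → Adjacent (minus 0) m (plus 0) m
    plus-step  : ∀ {c m} → c ℕ.< k → Adjacent (plus c) m (plus (suc c)) m
    wrap-step  : ∀ {m} → Adjacent (plus k) m (minus k) (m + + 1)

  adjacent-labels : ∀ {σ m σ′ m′} → Adjacent σ m σ′ m′ → downLabel σ′ ≡ upLabel σ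
  adjacent-labels minus-step    = refl
  adjacent-labels zero-step     = refl
  adjacent-labels (plus-step _) = refl
  adjacent-labels wrap-step     = refl

  sref-swaps-adjacent : ∀ {i σ m σ′ m′} → Adjacent σ m σ′ m′ → Valid σ → toℕ i ≡ upLabel σ →
    Swaps (sref n i) (value σ + m * P) (value σ′ + m′ * P)
  sref-swaps-adjacent {σ = minus (suc c)} {m} minus-step c<k e =
    subst (λ f → Swaps f _ _) (sym (sref-middle e c<k))
      (∘-swaps outer inner
        (swaps-sym inner (transposition-swaps -[1+ c ] -[1+ suc c ] m
          (points-apart (minus (suc c)) (minus c) m c<k c≤k (λ ()))))
        (cycleP-fixes (+ 0) _ ( points-apart (minus (suc c)) (plus c) m c<k c≤k (λ ())
                              ∷ points-apart (minus (suc c)) (plus (suc c)) m c<k c<k (λ ()) ∷ []))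
        (cycleP-fixes (+ 0) _ ( points-apart (minus c) (plus c) m c≤k c≤k (λ ())
                              ∷ points-apart (minus c) (plus (suc c)) m c≤k c<k (λ ()) ∷ [])))
    where
    c≤k = ℕₚ.<⇒≤ c<k
    outer = transposition (+ suc c) (+ suc (suc c))
    inner = transposition -[1+ c ] -[1+ suc c ]
  sref-swaps-adjacent {m = m} zero-step _ e =
    subst (λ f → Swaps f _ _) (sym (sref-first e))
      (transposition-swaps -[1+ 0 ] (+ 1) m (points-apart (plus 0) (minus 0) m z≤n z≤n (λ ())))
  sref-swaps-adjacent {m = m} (plus-step {c} c<k) _ e =
    subst (λ f → Swaps f _ _) (sym (sref-middle e c<k))
      (swaps-∘ outer inner
        (cycleP-fixes (+ 0) _ ( points-apart (plus c) (minus c) m c≤k c≤k (λ ())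
                              ∷ points-apart (plus c) (minus (suc c)) m c≤k c<k (λ ()) ∷ []))
        (cycleP-fixes (+ 0) _ ( points-apart (plus (suc c)) (minus c) m c<k c≤k (λ ())
                              ∷ points-apart (plus (suc c)) (minus (suc c)) m c<k c<k (λ ()) ∷ []))
        (transposition-swaps (+ suc c) (+ suc (suc c)) m (points-apart (plus (suc c)) (plus c) m c<k c≤k (λ ()))))
    where
    c≤k = ℕₚ.<⇒≤ c<k
    outer = transposition (+ suc c) (+ suc (suc c))
    inner = transposition -[1+ c ] -[1+ suc c ]
  sref-swaps-adjacent {m = m} wrap-step _ e =
    subst (λ f → Swaps f _ _) (sym (sref-last e))
      (subst (Swaps last-transposition (+ suc k + m * P)) (n+1-shift m)
        (transposition-swaps (+ suc k) (+ (n ℕ.+ 1)) m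
          (subst (λ x → Incongruent x (+ suc k)) (sym (n+1-shift m))
            (points-apart (minus k) (plus k) (m + + 1) ℕₚ.≤-refl ℕₚ.≤-refl (λ ())))))
    where
    last-transposition = transposition (+ suc k) (+ (n ℕ.+ 1))

  L : ℕ
  L = suc k ℕ.+ suc k

  -- index lists -(n-1) < ⋯ < -1 < 1 < ⋯ < n-1 as 0, …, L-1, so that val t enumerates the integers
  -- not divisible by n in increasing order.
  index : Signed → ℕ
  index (minus c) = k ∸ c
  index (plus c)  = suc k ℕ.+ c

  signed : ℕ → Signed
  signed j with j ℕ.<? suc k
  ... | yes _ = minus (k ∸ j)
  ... | no  _ = plus (j ∸ suc k)

  signed-index : ∀ σ → Valid σ → signed (index σ) ≡ σ
  signed-index (minus c) c≤k with k ∸ c ℕ.<? suc k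
  ... | yes _    = cong minus (ℕₚ.m∸[m∸n]≡n c≤k)
  ... | no  k∸c≮ = ⊥-elim (k∸c≮ (s≤s (ℕₚ.m∸n≤m k c)))
  signed-index (plus c) _ with suc k ℕ.+ c ℕ.<? suc k
  ... | yes k+c< = ⊥-elim (ℕₚ.<⇒≱ k+c< (ℕₚ.m≤m+n (suc k) c))
  ... | no  _    = cong plus (ℕₚ.m+n∸m≡n (suc k) c)

  index-signed : ∀ j → j ℕ.< L → Valid (signed j) × index (signed j) ≡ j
  index-signed j j<L with j ℕ.<? suc k
  ... | yes j<1+k = ℕₚ.m∸n≤m k j , ℕₚ.m∸[m∸n]≡n (ℕₚ.≤-pred j<1+k)
  ... | no  j≮1+k = ℕₚ.≤-pred (ℕₚ.m<n+o⇒m∸n<o j (suc k) j<L) , ℕₚ.m+[n∸m]≡n (ℕₚ.≮⇒≥ j≮1+k)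

  index<L : ∀ σ → Valid σ → index σ ℕ.< L
  index<L (minus c) _   = s≤s (ℕₚ.≤-trans (ℕₚ.m∸n≤m k c) (ℕₚ.m≤m+n k (suc k)))
  index<L (plus c)  c≤k = ℕₚ.+-monoʳ-< (suc k) (s≤s c≤k)

  record At (t : ℤ) (σ : Signed) (m : ℤ) : Set where
    constructor at
    field
      valid    : Valid σ
      position : t ≡ + index σ + m * + L
  open At public

  at-coordinates : ∀ {t σ m} → At t σ m → signed (t %ℕ L) ≡ σ × t /ℕ L ≡ m
  at-coordinates {σ = σ} {m} (at vσ e) with divMod-unique L m (index<L σ vσ) e
  ... | r≡ , q≡ = trans (cong signed r≡) (signed-index σ vσ) , q≡

  -- Opaque: letting the unifier unfold val, lab and labD makes type checking explode.
  opaque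
    val : ℤ → ℤ
    val t = value (signed (t %ℕ L)) + (t /ℕ L) * P

    lab labD : ℤ → ℕ
    lab  t = upLabel (signed (t %ℕ L))
    labD t = downLabel (signed (t %ℕ L))

    val-at : ∀ {t σ m} → At t σ m → val t ≡ value σ + m * P
    val-at a = cong₂ (λ σ m → value σ + m * P) (proj₁ (at-coordinates a)) (proj₂ (at-coordinates a))

    lab-at : ∀ {t σ m} → At t σ m → lab t ≡ upLabel σ
    lab-at a = cong upLabel (proj₁ (at-coordinates a))

    labD-at : ∀ {t σ m} → At t σ m → labD t ≡ downLabel σ
    labD-at a = cong downLabel (proj₁ (at-coordinates a))

  locate : ∀ t → ∃ λ σ → ∃ λ m → At t σ m
  locate t with index-signed (t %ℕ L) (n%ℕd<d t L)
  ... | vσ , idx≡ = signed (t %ℕ L) , t /ℕ L , at vσ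
        (trans (a≡a%ℕn+[a/ℕn]*n t L) (cong (λ j → + j + t /ℕ L * + L) (sym idx≡)))

  at-suc : ∀ {t} j m → t ≡ + j + m * + L → t + + 1 ≡ + suc j + m * + L
  at-suc {t} j m e = trans (cong (_+ + 1) e) (trans (swap (+ j) (m * + L)) (cong (_+ m * + L) (sym (ℤₚ.pos-+ 1 j))))
    where
    swap : ∀ a b → a + b + + 1 ≡ + 1 + a + b
    swap = solve-∀

  adjacent : ∀ {t σ m} → At t σ m → ∃ λ σ′ → ∃ λ m′ → Adjacent σ m σ′ m′ × At (t + + 1) σ′ m′
  adjacent {σ = minus (suc c)} {m} (at c<k e) =
    minus c , _ , minus-step ,
    at (ℕₚ.<⇒≤ c<k) (trans (at-suc (k ∸ suc c) m e) (cong (λ j → + j + m * + L) (sym (ℕₚ.+-∸-assoc 1 c<k))))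
  adjacent {σ = minus zero} {m} (at _ e) =
    plus 0 , _ , zero-step , at z≤n (trans (at-suc k m e) (cong (λ j → + j + m * + L) (sym (ℕₚ.+-identityʳ (suc k)))))
  adjacent {σ = plus c} {m} (at c≤k e) with c ℕ.<? k
  ... | yes c<k = plus (suc c) , _ , plus-step c<k , at c<k
        (trans (at-suc (suc k ℕ.+ c) m e) (cong (λ j → + j + m * + L) (sym (ℕₚ.+-suc (suc k) c))))
  ... | no c≮k with ℕₚ.≤-antisym c≤k (ℕₚ.≮⇒≥ c≮k)
  ...   | refl = minus k , _ , wrap-step , at ℕₚ.≤-refl (trans (at-suc (suc k ℕ.+ k) m e) (wrap m))
    where
    wrap : ∀ m → + suc (suc k ℕ.+ k) + m * + L ≡ + (k ∸ k) + (m + + 1) * + L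
    wrap m = trans (cong (λ j → + j + m * + L) (sym (ℕₚ.+-suc (suc k) k)))
               (trans (period (+ L) m) (cong (λ j → + j + (m + + 1) * + L) (sym (ℕₚ.n∸n≡0 k))))
      where
      period : ∀ l m → l + m * l ≡ + 0 + (m + + 1) * l
      period = solve-∀

  sref-swaps : ∀ i t → toℕ i ≡ lab t → Swaps (sref n i) (val t) (val (t + + 1))
  sref-swaps i t i≡ with locate t
  ... | σ , m , a with adjacent a
  ...   | σ′ , m′ , adj , a′ = subst₂ (Swaps (sref n i)) (sym (val-at a)) (sym (val-at a′))
          (sref-swaps-adjacent adj (valid a) (trans i≡ (lab-at a)))

  labD-suc : ∀ t → labD (t + + 1) ≡ lab t
  labD-suc t with locate t
  ... | σ , m , a with adjacent a
  ...   | σ′ , m′ , adj , a′ = trans (labD-at a′) (trans (adjacent-labels adj) (sym (lab-at a)))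

  sref-fixes-point : ∀ i t → toℕ i ≢ lab t → toℕ i ≢ labD t → sref n i (val t) ≡ val t
  sref-fixes-point i t i≢l i≢l′ with locate t
  ... | σ , m , a = subst (λ x → sref n i x ≡ x) (sym (val-at a))
        (sref-fixes (kind i) m (value-centered {σ} (valid a)) (All.map not-moved (moved-moves (kind i))))
    where
    not-moved : ∀ {τ} → Moves i τ → value σ ≢ value τ
    not-moved (_ , inj₁ i≡) v≡ = i≢l  (trans i≡ (trans (cong upLabel (sym (value-injective v≡))) (sym (lab-at a))))
    not-moved (_ , inj₂ i≡) v≡ = i≢l′ (trans i≡ (trans (cong downLabel (sym (value-injective v≡))) (sym (labD-at a))))

  -- The centered representatives of the multiples of n.
  Special : ℤ → Set
  Special v = v ≡ + 0 ⊎ v ≡ + n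

  special-≢-value : ∀ {v} σ → Special v → Valid σ → v ≢ value σ
  special-≢-value (minus _) (inj₁ refl) _ ()
  special-≢-value (plus _)  (inj₁ refl) _ ()
  special-≢-value (minus _) (inj₂ refl) _ ()
  special-≢-value (plus c)  (inj₂ refl) c≤k v≡ =
    ℕₚ.<-irrefl refl (subst (ℕ._≤ k) (sym (ℕₚ.suc-injective (ℤₚ.+-injective v≡))) c≤k)

  special-centered : ∀ {v} → Special v → Centered v
  special-centered (inj₁ refl) = -<+ , +≤+ z≤n
  special-centered (inj₂ refl) = -<+ , ℤₚ.≤-refl

  sref-fixes-special : ∀ i {v} m → Special v → sref n i (v + m * P) ≡ v + m * P
  sref-fixes-special i m sv =
    sref-fixes (kind i) m (special-centered sv) (All.map (λ {τ} → special-≢-value τ sv ∘ proj₁) (moved-moves (kind i)))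

  upLabel-< : ∀ σ → Valid σ → upLabel σ ℕ.< n
  upLabel-< (minus c) c≤k = s≤s (ℕₚ.m≤n⇒m≤1+n c≤k)
  upLabel-< (plus c)  c≤k = s≤s (s≤s c≤k)

  downLabel-< : ∀ σ → Valid σ → downLabel σ ℕ.< n
  downLabel-< (minus c) c≤k = s≤s (s≤s c≤k)
  downLabel-< (plus c)  c≤k = s≤s (ℕₚ.m≤n⇒m≤1+n c≤k)

  upLabel≢downLabel : ∀ σ → upLabel σ ≢ downLabel σ
  upLabel≢downLabel (minus c) ()
  upLabel≢downLabel (plus c)  ()

  value-< : ∀ σ τ → Valid σ → Valid τ → index σ ℕ.< index τ → value σ < value τ
  value-< (minus c) (minus d) _ _ i<j with c ℕ.≤? d
  ... | yes c≤d = ⊥-elim (ℕₚ.<⇒≱ i<j (ℕₚ.∸-monoʳ-≤ k c≤d))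
  ... | no  c≰d = -<- (ℕₚ.≰⇒> c≰d)
  value-< (minus c) (plus d)  _   _ _   = -<+
  value-< (plus c)  (minus d) _   _ i<j =
    ⊥-elim (ℕₚ.<⇒≱ i<j (ℕₚ.≤-trans (ℕₚ.m∸n≤m k d) (ℕₚ.≤-trans (ℕₚ.n≤1+n k) (ℕₚ.m≤m+n (suc k) c))))
  value-< (plus c)  (plus d)  _   _ i<j = +<+ (s≤s (ℕₚ.+-cancelˡ-< (suc k) c d i<j))

  index-< : ∀ σ τ → Valid σ → Valid τ → value σ < value τ → index σ ℕ.< index τ
  index-< σ τ vσ vτ v< with ℕₚ.<-cmp (index σ) (index τ)
  ... | tri< i<j _ _ = i<j
  ... | tri≈ _ i≡j _ =
    ⊥-elim (ℤₚ.<-irrefl (cong value (trans (sym (signed-index σ vσ)) (trans (cong signed i≡j) (signed-index τ vτ)))) v<)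
  ... | tri> _ _ j<i = ⊥-elim (ℤₚ.<-asym v< (value-< τ σ vτ vσ j<i))

  flip : Signed → Signed
  flip (minus c) = plus c
  flip (plus c)  = minus c

  valid-flip : ∀ σ → Valid σ → Valid (flip σ)
  valid-flip (minus _) c≤k = c≤k
  valid-flip (plus _)  c≤k = c≤k

  mirror : ℤ → ℤ
  mirror t = + (k ℕ.+ suc k) - t

  at-mirror : ∀ {t σ m} → At t σ m → At (mirror t) (flip σ) (- m)
  at-mirror {t} {σ} {m} (at vσ e) = at (valid-flip σ vσ)
    (trans (cong (λ x → + (k ℕ.+ suc k) - x) e)
      (trans (cong (_- (+ index σ + m * + L)) (trans (cong +_ (sym (indices σ vσ))) (ℤₚ.pos-+ (index σ) _)))
        (reflect (+ index σ) (+ index (flip σ)) m (+ L))))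
    where
    indices : ∀ σ → Valid σ → index σ ℕ.+ index (flip σ) ≡ k ℕ.+ suc k
    indices (minus c) c≤k = trans (sym (ℕₚ.+-assoc (k ∸ c) (suc k) c))
      (trans (ℕₚ.+-comm (k ∸ c ℕ.+ suc k) c) (trans (sym (ℕₚ.+-assoc c (k ∸ c) (suc k)))
        (cong (ℕ._+ suc k) (ℕₚ.m+[n∸m]≡n c≤k))))
    indices (plus c)  c≤k = trans (ℕₚ.+-comm (suc k ℕ.+ c) (k ∸ c)) (indices (minus c) c≤k)
    reflect : ∀ a b m l → a + b - (a + m * l) ≡ b + (- m) * l
    reflect = solve-∀

  val-mirror : ∀ t → val (mirror t) ≡ - val t
  val-mirror t with locate t
  ... | σ , m , a = trans (val-at (at-mirror a)) (trans (negate σ m) (cong -_ (sym (val-at a))))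
    where
    negate : ∀ σ m → value (flip σ) + (- m) * P ≡ - (value σ + m * P)
    negate (minus c) m = sym (neg-shift -[1+ c ] m)
    negate (plus c)  m = sym (neg-shift (+ suc c) m)

  lab-mirror : ∀ t → lab (mirror t) ≡ labD t
  lab-mirror t with locate t
  ... | minus c , m , a = trans (lab-at (at-mirror a)) (sym (labD-at a))
  ... | plus c  , m , a = trans (lab-at (at-mirror a)) (sym (labD-at a))

  labD-mirror : ∀ t → labD (mirror t) ≡ lab t
  labD-mirror t with locate t
  ... | minus c , m , a = trans (labD-at (at-mirror a)) (sym (lab-at a))
  ... | plus c  , m , a = trans (labD-at (at-mirror a)) (sym (lab-at a))

  mirror-shift : ∀ t d → mirror (mirror t + + 1 + d) ≡ t - + 1 - d
  mirror-shift t d = shift (+ (k ℕ.+ suc k)) t d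
    where
    shift : ∀ a t d → a - (a - t + + 1 + d) ≡ t - + 1 - d
    shift = solve-∀

  centered-representative : ∀ x → ∃ λ v → ∃ λ q → Centered v × x ≡ v + q * P
  centered-representative x with x %ℕ (2 ℕ.* n) ℕ.≤? n
  ... | yes r≤n = + r , q , (-<+ , +≤+ r≤n) , a≡a%ℕn+[a/ℕn]*n x (2 ℕ.* n)
    where
    r = x %ℕ (2 ℕ.* n)
    q = x /ℕ (2 ℕ.* n)
  ... | no  r≰n = + r - P , q + + 1 , (lower , upper) , trans (a≡a%ℕn+[a/ℕn]*n x (2 ℕ.* n)) (carry (+ r) q P)
    where
    r = x %ℕ (2 ℕ.* n)
    q = x /ℕ (2 ℕ.* n)
    carry : ∀ r q P → r + q * P ≡ r - P + (q + + 1) * P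
    carry = solve-∀
    lower : - + n < + r - P
    lower = subst (_< + r - P) (trans (cong (λ Q → + n - Q) P≡n+n) (cancel (+ n)))
              (ℤₚ.+-monoˡ-< (- P) (+<+ (ℕₚ.≰⇒> r≰n)))
      where
      cancel : ∀ a → a - (a + a) ≡ - a
      cancel = solve-∀
    upper : + r - P ≤ + n
    upper = subst (_≤ + n) (sym (trans (ℤₚ.m-n≡m⊖n r (2 ℕ.* n)) (ℤₚ.⊖-≤ (ℕₚ.<⇒≤ (n%ℕd<d x (2 ℕ.* n))))))
              ℤₚ.neg-≤-pos

  classify-centered : ∀ {v} → Centered v → Special v ⊎ ∃ λ σ → Valid σ × v ≡ value σ
  classify-centered {+ zero}    _              = inj₁ (inj₁ refl)
  classify-centered {+ suc c}   (_ , +≤+ c<n) with c ℕ.<? suc k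
  ... | yes c<1+k = inj₂ (plus c , ℕₚ.≤-pred c<1+k , refl)
  ... | no  c≮1+k = inj₁ (inj₂ (cong (λ d → + suc d) (ℕₚ.≤-antisym (ℕₚ.≤-pred c<n) (ℕₚ.≮⇒≥ c≮1+k))))
  classify-centered { -[1+ c ]} (-<- c<1+k , _) = inj₂ (minus c , ℕₚ.≤-pred c<1+k , refl)

  points-and-specials : ∀ x → (∃ λ v → ∃ λ q → Special v × x ≡ v + q * P) ⊎ ∃ λ t → x ≡ val t
  points-and-specials x with centered-representative x
  ... | v , q , cv , x≡ with classify-centered cv
  ...   | inj₁ sv             = inj₁ (v , q , sv , x≡)
  ...   | inj₂ (σ , vσ , v≡) = inj₂ (+ index σ + q * + L ,
          trans x≡ (trans (cong (_+ q * P) v≡) (sym (val-at {m = q} (at vσ refl)))))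

  sref-raises : ∀ i t → toℕ i ≡ lab t → sref n i (val t) ≡ val (t + + 1)
  sref-raises i t i≡ = proj₁ (sref-swaps i t i≡)

  pred-suc : ∀ t → t - + 1 + + 1 ≡ t
  pred-suc = solve-∀

  lab-pred : ∀ t → lab (t - + 1) ≡ labD t
  lab-pred t = trans (sym (labD-suc (t - + 1))) (cong labD (pred-suc t))

  sref-lowers : ∀ i t → toℕ i ≡ labD t → sref n i (val t) ≡ val (t - + 1)
  sref-lowers i t i≡ = subst (λ s → sref n i (val s) ≡ val (t - + 1)) (pred-suc t)
    (proj₂ (sref-swaps i (t - + 1) (trans i≡ (sym (lab-pred t)))))

  lab-< : ∀ t → lab t ℕ.< n
  lab-< t with locate t
  ... | σ , m , a = subst (ℕ._< n) (sym (lab-at a)) (upLabel-< σ (valid a))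

  labD-< : ∀ t → labD t ℕ.< n
  labD-< t with locate t
  ... | σ , m , a = subst (ℕ._< n) (sym (labD-at a)) (downLabel-< σ (valid a))

head∈ : ∀ {A : Set} (pre : List A) b post → headOr b pre ∈ pre ++ b ∷ post
head∈ []      b post = here refl
head∈ (a ∷ _) b post = here refl

module _ {A : Set} {_≺_ : A → A → Set} where

  below-entry : ∀ pre {b post} → AllPairs _≺_ (pre ++ b ∷ post) → All (_≺ b) pre
  below-entry []        _           = []
  below-entry (a ∷ pre) (a≺ ∷ rest) = All.head (Allₚ.++⁻ʳ pre a≺) ∷ below-entry pre rest

  sorted-suffix : ∀ pre {ys} → AllPairs _≺_ (pre ++ ys) → AllPairs _≺_ ys
  sorted-suffix []        sorted     = sorted
  sorted-suffix (_ ∷ pre) (_ ∷ rest) = sorted-suffix pre rest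

module _ {A : Set} {_≺_ : A → A → Set} (≺-irrefl : ∀ {x} → ¬ x ≺ x) (≺-asym : ∀ {x y} → x ≺ y → ¬ y ≺ x) where

  nothing-between : ∀ pre {b c post z} → AllPairs _≺_ (pre ++ b ∷ c ∷ post) → z ∈ pre ++ b ∷ c ∷ post →
    b ≺ z → z ≺ c → ⊥
  nothing-between pre sorted z∈ b≺z z≺c with ∈-++⁻ pre z∈ | sorted-suffix pre sorted
  ... | inj₁ z∈pre                   | _                   = ≺-asym b≺z (All.lookup (below-entry pre sorted) z∈pre)
  ... | inj₂ (here refl)             | _                   = ≺-irrefl b≺z
  ... | inj₂ (there (here refl))     | _                   = ≺-irrefl z≺c
  ... | inj₂ (there (there z∈post))  | _ ∷ (c≺post ∷ _)   = ≺-asym z≺c (All.lookup c≺post z∈post)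

  nothing-above-last : ∀ pre {b z} → AllPairs _≺_ (pre ++ b ∷ []) → z ∈ pre ++ b ∷ [] → b ≺ z → ⊥
  nothing-above-last pre sorted z∈ b≺z with ∈-++⁻ pre z∈
  ... | inj₁ z∈pre       = ≺-asym b≺z (All.lookup (below-entry pre sorted) z∈pre)
  ... | inj₂ (here refl) = ≺-irrefl b≺z

  nothing-below-head : ∀ pre {b post z} → AllPairs _≺_ (pre ++ b ∷ post) → z ∈ pre ++ b ∷ post →
    z ≺ headOr b pre → ⊥
  nothing-below-head []      _          (here refl) z≺b = ≺-irrefl z≺b
  nothing-below-head []      (b≺ ∷ _)   (there z∈)  z≺b = ≺-asym z≺b (All.lookup b≺ z∈)
  nothing-below-head (_ ∷ _) _          (here refl) z≺a = ≺-irrefl z≺a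
  nothing-below-head (_ ∷ _) (a≺ ∷ _)   (there z∈)  z≺a = ≺-asym z≺a (All.lookup a≺ z∈)

module Signing (k : ℕ) (w : List (Fin (suc (suc k)))) (w↭ : w ↭ allFin (suc (suc k)))
  (as : List ℤ) (as-sorted : Linked _<_ as) (as↭ : as ↭ signing (suc (suc k)) w) where

  open AffineC k

  w-unique : Unique w
  w-unique = ↭ₛ.Unique-resp-↭ (setoid (Fin n)) (↭⇒↭ₛ (↭-sym w↭)) (Uniqueₚ.allFin⁺ n)

  label-present : ∀ l → l ℕ.< n → pos w l ℕ.< length w
  label-present l l<n = pos-< w l (Any.map (λ i≡ → trans (cong toℕ (sym i≡)) (Finₚ.toℕ-fromℕ< l<n))
    (∈-resp-↭ (↭-sym w↭) (∈-allFin (Fin.fromℕ< l<n))))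

  positions-differ : ∀ l l′ → l ℕ.< n → l ≢ l′ → pos w l ≢ pos w l′
  positions-differ l l′ l<n l≢l′ e = l≢l′ (pos-injective w l l′ (label-present l l<n) e)

  Rising Falling : Signed → Set
  Rising  σ = Before w (downLabel σ) (upLabel σ)
  Falling σ = Before w (upLabel σ) (downLabel σ)

  rising-or-falling : ∀ σ → Valid σ → Rising σ ⊎ Falling σ
  rising-or-falling σ vσ with ℕₚ.<-cmp (pos w (downLabel σ)) (pos w (upLabel σ))
  ... | tri< r _ _ = inj₁ r
  ... | tri≈ _ e _ = ⊥-elim (positions-differ (upLabel σ) (downLabel σ) (upLabel-< σ vσ) (upLabel≢downLabel σ) (sym e))
  ... | tri> _ _ f = inj₂ f

  signOf : ℕ → ℤ
  signOf c = if pos w c <ᵇ pos w (suc c) then + suc c else - (+ suc c)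

  signOf-value : ∀ c → c ℕ.≤ k → ∃ λ σ → Valid σ × Rising σ × signOf c ≡ value σ
  signOf-value c c≤k with pos w c ℕ.<? pos w (suc c)
  ... | yes c<c′ = plus c , c≤k , c<c′ , if-true (dec-true (pos w c ℕ.<? pos w (suc c)) c<c′)
  ... | no  c≮c′ = minus c , c≤k , falling , if-false (dec-false (pos w c ℕ.<? pos w (suc c)) c≮c′)
    where
    falling : pos w (suc c) ℕ.< pos w c
    falling with rising-or-falling (minus c) c≤k
    ... | inj₁ r = r
    ... | inj₂ f = ⊥-elim (c≮c′ f)

  entry-rising : ∀ {z} → z ∈ as → ∃ λ σ → Valid σ × Rising σ × z ≡ value σ
  entry-rising z∈ with ∈-map⁻ signOf (∈-resp-↭ as↭ z∈)
  ... | c , c∈ , z≡ with signOf-value c (ℕₚ.≤-pred (∈-upTo⁻ c∈))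
  ...   | σ , vσ , rσ , e = σ , vσ , rσ , trans z≡ e

  rising-entry : ∀ σ → Valid σ → Rising σ → value σ ∈ as
  rising-entry (plus c)  c≤k r = ∈-resp-↭ (↭-sym as↭)
    (subst (_∈ signing n w) (if-true (dec-true (pos w c ℕ.<? pos w (suc c)) r)) (∈-map⁺ signOf (∈-upTo⁺ (s≤s c≤k))))
  rising-entry (minus c) c≤k r = ∈-resp-↭ (↭-sym as↭)
    (subst (_∈ signing n w) (if-false (dec-false (pos w c ℕ.<? pos w (suc c)) (ℕₚ.<-asym r)))
      (∈-map⁺ signOf (∈-upTo⁺ (s≤s c≤k))))

  module Up   = Climb (sref n) val (_+ + 1) lab labD labD-suc sref-raises sref-fixes-point
  module Down = Climb (sref n) val (_- + 1) labD lab lab-pred sref-lowers (λ i t i≢l′ i≢l → sref-fixes-point i t i≢l i≢l′)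

  Ascends Descends : ℤ → Set
  Ascends  = Up.Ascends w
  Descends = Up.Descends w

  rising-at : ∀ {t σ m} → At t σ m → Ascends t → Rising σ
  rising-at a = subst₂ (Before w) (labD-at a) (lab-at a)

  ascends-at : ∀ {t σ m} → At t σ m → Rising σ → Ascends t
  ascends-at a = subst₂ (Before w) (sym (labD-at a)) (sym (lab-at a))

  descends-at : ∀ {t σ m} → At t σ m → Falling σ → Descends t
  descends-at a = subst₂ (Before w) (sym (lab-at a)) (sym (labD-at a))

  ascends-or-descends : ∀ t → Ascends t ⊎ Descends t
  ascends-or-descends t with locate t
  ... | σ , m , a with rising-or-falling σ (valid a)
  ...   | inj₁ r = inj₁ (ascends-at a r)
  ...   | inj₂ f = inj₂ (descends-at a f)

  descends-unless-entry : ∀ {x σ m} → At x σ m → ¬ value σ ∈ as → Descends x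
  descends-unless-entry {σ = σ} a σ∉ with rising-or-falling σ (valid a)
  ... | inj₁ r = ⊥-elim (σ∉ (rising-entry σ (valid a) r))
  ... | inj₂ f = descends-at a f

  ascends-mirror : ∀ t → Descends t → Ascends (mirror t)
  ascends-mirror t = subst₂ (Before w) (sym (labD-mirror t)) (sym (lab-mirror t))

  descends-mirror : ∀ t → Ascends t → Descends (mirror t)
  descends-mirror t = subst₂ (Before w) (sym (lab-mirror t)) (sym (labD-mirror t))

  W : ℤ
  W = + 1 * P

  -- icyc (2 * n) (+ 1) as is C₊ ∘ C₋.
  C₊ C₋ : ℤ → ℤ
  C₊ = cycleP (2 ℕ.* n) W as
  C₋ = cycleP (2 ℕ.* n) (- W) (map -_ as)

  C₋-via-C₊ : ∀ y → C₋ y ≡ - C₊ (- y)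
  C₋-via-C₊ y = trans (cong C₋ (sym (ℤₚ.neg-involutive y))) (cycleP-neg W as (- y))

  C₊-fixes : ∀ {x} → (∀ σ → Valid σ → Rising σ → Incongruent x (value σ)) → C₊ x ≡ x
  C₊-fixes {x} avoid = cycleP-fixes W as (All.tabulate avoid-entry)
    where
    avoid-entry : ∀ {z} → z ∈ as → Incongruent x z
    avoid-entry z∈ with entry-rising z∈
    ... | σ , vσ , rσ , refl = avoid σ vσ rσ

  C₊-descending : ∀ t → Descends t → C₊ (val t) ≡ val t
  C₊-descending t desc with locate t
  ... | σ , m , a = subst (λ x → C₊ x ≡ x) (sym (val-at a)) (C₊-fixes avoid)
    where
    avoid : ∀ τ → Valid τ → Rising τ → Incongruent (value σ + m * P) (value τ)
    avoid τ vτ rτ = points-apart σ τ m (valid a) vτ λ σ≡τ →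
      ℕₚ.<-asym (ascends-at a (subst Rising (sym (value-injective σ≡τ)) rτ)) desc

  Unmoved : ℤ → Set
  Unmoved x = ∀ σ → Valid σ → Incongruent x (value σ)

  special-unmoved : ∀ {v} q → Special v → Unmoved (v + q * P)
  special-unmoved q sv σ vσ = centered-incongruent q (special-centered sv) (value-centered {σ} vσ) (special-≢-value σ sv vσ)

  unmoved-neg : ∀ {x} → Unmoved x → Unmoved (- x)
  unmoved-neg {x} u σ vσ = subst (Incongruent (- x)) (negate σ) (incongruent-neg (u (flip σ) (valid-flip σ vσ)))
    where
    negate : ∀ σ → - value (flip σ) ≡ value σ
    negate (minus _) = refl
    negate (plus _)  = refl

  icyc-unmoved : ∀ {x} → Unmoved x → C₊ (C₋ x) ≡ x
  icyc-unmoved {x} u =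
    trans (cong C₊ (trans (C₋-via-C₊ x) (trans (cong -_ (C₊-fixes λ σ vσ _ → unmoved-neg u σ vσ)) (ℤₚ.neg-involutive x))))
                             (C₊-fixes λ σ vσ _ → u σ vσ)

  NextAscent : ℤ → ℕ → Set
  NextAscent t k′ = (∀ d → d ℕ.< k′ → Descends (t + + 1 + + d)) × Ascends (t + + 1 + + k′)

  at-index : ∀ {x} i m → i ℕ.< L → x ≡ + i + m * + L → At x (signed i) m
  at-index i m i<L x≡ = at (proj₁ (index-signed i i<L))
    (trans x≡ (cong (λ j → + j + m * + L) (sym (proj₂ (index-signed i i<L)))))

  shift-index : ∀ {t} j m d → t ≡ + j + m * + L → t + + 1 + + d ≡ + (suc j ℕ.+ d) + m * + L
  shift-index {t} j m d t≡ = trans (cong (λ x → x + + 1 + + d) t≡)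
    (trans (regroup (+ j) (m * + L) (+ d)) (cong (_+ m * + L) (sym (trans (ℤₚ.pos-+ (suc j) d) (cong (_+ + d) (ℤₚ.pos-+ 1 j))))))
    where
    regroup : ∀ j l d → j + l + + 1 + d ≡ + 1 + j + d + l
    regroup = solve-∀

  gap⇒next-ascent : ∀ {t j m} j″ → t ≡ + j + m * + L → j ℕ.< j″ →
    (∀ i → j ℕ.< i → i ℕ.< j″ → Descends (+ i + m * + L)) → Ascends (+ j″ + m * + L) →
    NextAscent t (j″ ∸ suc j) × t + + 1 + + (j″ ∸ suc j) ≡ + j″ + m * + L
  gap⇒next-ascent {t} {j} {m} j″ t≡ j<j″ between asc = (descending , subst Ascends (sym reach) asc) , reach
    where
    reach : t + + 1 + + (j″ ∸ suc j) ≡ + j″ + m * + L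
    reach = trans (shift-index j m _ t≡) (cong (λ i → + i + m * + L) (ℕₚ.m+[n∸m]≡n j<j″))
    descending : ∀ d → d ℕ.< j″ ∸ suc j → Descends (t + + 1 + + d)
    descending d d< = subst Descends (sym (shift-index j m d t≡)) (between (suc j ℕ.+ d) (s≤s (ℕₚ.m≤m+n j d))
      (subst (suc j ℕ.+ d ℕ.<_) (ℕₚ.m+[n∸m]≡n j<j″) (ℕₚ.+-monoʳ-< (suc j) d<)))

  NextEntry : ℤ → Signed → ℤ → Set
  NextEntry t σ m = ∃ λ j″ → index σ ℕ.< j″ × (∀ i → index σ ℕ.< i → i ℕ.< j″ → Descends (+ i + m * + L)) ×
    Ascends (+ j″ + m * + L) × C₊ (val t) ≡ val (+ j″ + m * + L)

  module AfterEntry {t σ m} (a : At t σ m) (pre post : List ℤ) (as≡ : as ≡ pre ++ value σ ∷ post) where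

    sorted : AllPairs _<_ (pre ++ value σ ∷ post)
    sorted = subst (AllPairs _<_) as≡ (Linked⇒AllPairs ℤₚ.<-trans as-sorted)

    in-as : ∀ {z} → z ∈ as → z ∈ pre ++ value σ ∷ post
    in-as {z} = subst (z ∈_) as≡

    from-as : ∀ {z} → z ∈ pre ++ value σ ∷ post → z ∈ as
    from-as {z} = subst (z ∈_) (sym as≡)

    C₊-hit : C₊ (val t) ≡ nextEntry (headOr (value σ) pre + W) post + m * P
    C₊-hit = trans (cong C₊ (val-at a)) (trans (cong (λ l → cycleP (2 ℕ.* n) W l (value σ + m * P)) as≡)
      (cycleP-hit W pre (value σ) post m (All.tabulate avoid) refl))
      where
      avoid : ∀ {z} → z ∈ pre → Incongruent (value σ + m * P) z
      avoid z∈ with entry-rising (from-as (∈-++⁺ˡ z∈))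
      ... | τ , vτ , _ , refl = points-apart σ τ m (valid a) vτ
            (λ σ≡τ → ℤₚ.<⇒≢ (All.lookup (below-entry pre sorted) z∈) (sym σ≡τ))

    above : ∀ i → index σ ℕ.< i → i ℕ.< L → value σ < value (signed i)
    above i σ<i i<L = value-< σ (signed i) (valid a) (proj₁ (index-signed i i<L))
                        (subst (index σ ℕ.<_) (sym (proj₂ (index-signed i i<L))) σ<i)

    last-entry : post ≡ [] → NextEntry t σ m
    last-entry refl with entry-rising (from-as (head∈ pre (value σ) []))
    ... | τ , vτ , rτ , head≡ = L ℕ.+ index τ , ℕₚ.<-≤-trans (index<L σ (valid a)) (ℕₚ.m≤m+n L _) ,
          between , ascends-at a′ rτ , value≡
      where
      carry : ∀ i m → + (L ℕ.+ i) + m * + L ≡ + i + (m + + 1) * + L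
      carry i m = trans (cong (_+ m * + L) (ℤₚ.pos-+ L i)) (regroup (+ L) (+ i) m)
        where
        regroup : ∀ l i m → l + i + m * l ≡ i + (m + + 1) * l
        regroup = solve-∀
      a′ : At (+ (L ℕ.+ index τ) + m * + L) τ (m + + 1)
      a′ = at vτ (carry (index τ) m)
      between : ∀ i → index σ ℕ.< i → i ℕ.< L ℕ.+ index τ → Descends (+ i + m * + L)
      between i σ<i i< with i ℕ.<? L
      ... | yes i<L = descends-unless-entry (at-index i m i<L refl) λ ∈as →
            nothing-above-last (ℤₚ.<-irrefl refl) ℤₚ.<-asym pre sorted (in-as ∈as) (above i σ<i i<L)
      ... | no  i≮L = descends-unless-entry (at-index (i ∸ L) (m + + 1) (ℕₚ.<-trans i′<τ (index<L τ vτ)) i≡) λ ∈as →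
            nothing-below-head (ℤₚ.<-irrefl refl) ℤₚ.<-asym pre sorted (in-as ∈as)
              (subst (value (signed (i ∸ L)) <_) (sym head≡)
                (value-< (signed (i ∸ L)) τ (proj₁ (index-signed _ i′<L)) vτ
                  (subst (ℕ._< index τ) (sym (proj₂ (index-signed _ i′<L))) i′<τ)))
        where
        L+i′≡i : L ℕ.+ (i ∸ L) ≡ i
        L+i′≡i = ℕₚ.m+[n∸m]≡n (ℕₚ.≮⇒≥ i≮L)
        i′<τ : i ∸ L ℕ.< index τ
        i′<τ = ℕₚ.+-cancelˡ-< L _ _ (subst (ℕ._< L ℕ.+ index τ) (sym L+i′≡i) i<)
        i′<L : i ∸ L ℕ.< L
        i′<L = ℕₚ.<-trans i′<τ (index<L τ vτ)
        i≡ : + i + m * + L ≡ + (i ∸ L) + (m + + 1) * + L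
        i≡ = trans (cong (λ x → + x + m * + L) (sym L+i′≡i)) (carry (i ∸ L) m)
      value≡ : C₊ (val t) ≡ val (+ (L ℕ.+ index τ) + m * + L)
      value≡ = trans C₊-hit (trans (cong (λ h → h + W + m * P) head≡)
                 (trans (regroup (value τ) m P) (sym (val-at a′))))
        where
        regroup : ∀ v m p → v + + 1 * p + m * p ≡ v + (m + + 1) * p
        regroup = solve-∀

    inner-entry : ∀ b post′ → post ≡ b ∷ post′ → NextEntry t σ m
    inner-entry b post′ refl with entry-rising (from-as (∈-++⁺ʳ pre (there (here refl))))
    ... | τ , vτ , rτ , refl = index τ , σ<τ , between , ascends-at aτ rτ , trans C₊-hit (sym (val-at aτ))
      where
      aτ : At (+ index τ + m * + L) τ m
      aτ = at vτ refl
      σ<τ : index σ ℕ.< index τ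
      σ<τ with sorted-suffix pre sorted
      ... | σ≺ ∷ _ = index-< σ τ (valid a) vτ (All.head σ≺)
      between : ∀ i → index σ ℕ.< i → i ℕ.< index τ → Descends (+ i + m * + L)
      between i σ<i i<τ = descends-unless-entry (at-index i m i<L refl) λ ∈as →
        nothing-between (ℤₚ.<-irrefl refl) ℤₚ.<-asym pre sorted (in-as ∈as) (above i σ<i i<L)
          (value-< (signed i) τ (proj₁ (index-signed i i<L)) vτ (subst (ℕ._< index τ) (sym (proj₂ (index-signed i i<L))) i<τ))
        where
        i<L = ℕₚ.<-trans i<τ (index<L τ vτ)

  next-entry : ∀ {t σ m} (a : At t σ m) pre post → as ≡ pre ++ value σ ∷ post → NextEntry t σ m
  next-entry a pre []          as≡ = AfterEntry.last-entry a pre [] as≡ refl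
  next-entry a pre (b ∷ post′) as≡ = AfterEntry.inner-entry a pre (b ∷ post′) as≡ b post′ refl

  C₊-ascent : ∀ t → Ascends t → ∃ λ k′ → NextAscent t k′ × C₊ (val t) ≡ val (t + + 1 + + k′)
  C₊-ascent t asc with locate t
  ... | σ , m , a with ∈-∃++ (rising-entry σ (valid a) (rising-at a asc))
  ...   | pre , post , as≡ with next-entry a pre post as≡
  ...     | j″ , σ<j″ , between , asc″ , C₊≡ with gap⇒next-ascent {m = m} j″ (position a) σ<j″ between asc″
  ...       | next , reach = _ , next , trans C₊≡ (cong val (sym reach))

  climb-up : ∀ d t → Up.climb d t ≡ t + + d
  climb-up zero    t = sym (ℤₚ.+-identityʳ t)
  climb-up (suc d) t =
    trans (climb-up d (t + + 1)) (trans (ℤₚ.+-assoc t (+ 1) (+ d)) (cong (λ x → t + x) (sym (ℤₚ.pos-+ 1 d))))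

  climb-down : ∀ d t → Down.climb d t ≡ t - + d
  climb-down zero    t = sym (ℤₚ.+-identityʳ t)
  climb-down (suc d) t = trans (climb-down d (t - + 1)) (trans (ℤₚ.+-assoc t (- + 1) (- + d))
    (cong (λ x → t + x) (trans (sym (ℤₚ.neg-distrib-+ (+ 1) (+ d))) (cong -_ (sym (ℤₚ.pos-+ 1 d))))))

  prod-ascending : ∀ t k′ → Ascends t → NextAscent t k′ → prodS n w (val t) ≡ val (t + + 1 + + k′)
  prod-ascending t k′ asc (desc , asc′) =
    trans (Up.act-climbs w w-unique k′ t (label-present (lab t) (lab-< t)) asc
            (λ d d<k′ → subst Descends (sym (climb-up d (t + + 1))) (desc d d<k′))
            (subst Ascends (sym (climb-up k′ (t + + 1))) asc′))
          (cong val (climb-up k′ (t + + 1)))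

  prod-descending : ∀ t k′ → Descends t → NextAscent (mirror t) k′ → prodS n w (val t) ≡ val (t - + 1 - + k′)
  prod-descending t k′ desc (desc′ , asc′) =
    trans (Down.act-climbs w w-unique k′ t (label-present (labD t) (labD-< t)) desc
            (λ d d<k′ → subst Ascends (trans (mirror-shift t (+ d)) (sym (climb-down d (t - + 1))))
                          (ascends-mirror _ (desc′ d d<k′)))
            (subst Descends (trans (mirror-shift t (+ k′)) (sym (climb-down k′ (t - + 1))))
              (descends-mirror _ asc′)))
          (cong val (climb-down k′ (t - + 1)))

  prod-fixes-special : ∀ u {v} q → Special v → prodS n u (v + q * P) ≡ v + q * P
  prod-fixes-special []      q sv = refl
  prod-fixes-special (i ∷ u) q sv = trans (cong (sref n i) (prod-fixes-special u q sv)) (sref-fixes-special i q sv)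

  C₋-val : ∀ t → C₋ (val t) ≡ - C₊ (val (mirror t))
  C₋-val t = trans (C₋-via-C₊ (val t)) (cong (λ y → - C₊ y) (sym (val-mirror t)))

  Agrees : ℤ → Set
  Agrees x = prodS n w x ≡ C₊ (C₋ x)

  C₋-ascending : ∀ t → Ascends t → C₋ (val t) ≡ val t
  C₋-ascending t asc = trans (C₋-val t) (trans (cong -_ (C₊-descending (mirror t) (descends-mirror t asc)))
    (trans (cong -_ (val-mirror t)) (ℤₚ.neg-involutive (val t))))

  agrees-ascending : ∀ t → Ascends t → Agrees (val t)
  agrees-ascending t asc = from (C₊-ascent t asc)
    where
    from : (∃ λ k′ → NextAscent t k′ × C₊ (val t) ≡ val (t + + 1 + + k′)) → Agrees (val t)
    from (k′ , next , C₊≡) =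
      trans (prod-ascending t k′ asc next) (trans (sym C₊≡) (cong C₊ (sym (C₋-ascending t asc))))

  agrees-descending : ∀ t → Descends t → Agrees (val t)
  agrees-descending t desc = from (C₊-ascent (mirror t) (ascends-mirror t desc))
    where
    from : (∃ λ k′ → NextAscent (mirror t) k′ × C₊ (val (mirror t)) ≡ val (mirror t + + 1 + + k′)) → Agrees (val t)
    from (k′ , next , C₊≡) = begin
      prodS n w (val t)          ≡⟨ prod-descending t k′ desc next ⟩
      val (t - + 1 - + k′)       ≡⟨ sym (C₊-descending _ lower-descends) ⟩
      C₊ (val (t - + 1 - + k′))  ≡⟨ cong C₊ (sym C₋≡) ⟩
      C₊ (C₋ (val t))            ∎
      where
      open ≡-Reasoning
      lower-descends : Descends (t - + 1 - + k′)
      lower-descends = subst Descends (mirror-shift t (+ k′)) (descends-mirror _ (proj₂ next))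
      C₋≡ : C₋ (val t) ≡ val (t - + 1 - + k′)
      C₋≡ = trans (C₋-val t) (trans (cong -_ C₊≡) (trans (sym (val-mirror _)) (cong val (mirror-shift t (+ k′)))))

  agrees-special : ∀ {v} q → Special v → Agrees (v + q * P)
  agrees-special q sv = trans (prod-fixes-special w q sv) (sym (icyc-unmoved (special-unmoved q sv)))

  agrees : ∀ x → Agrees x
  agrees x = from (points-and-specials x)
    where
    from : (∃ λ v → ∃ λ q → Special v × x ≡ v + q * P) ⊎ (∃ λ t → x ≡ val t) → Agrees x
    from (inj₁ (v , q , sv , x≡)) = subst Agrees (sym x≡) (agrees-special q sv)
    from (inj₂ (t , x≡)) = subst Agrees (sym x≡) ([ agrees-ascending t , agrees-descending t ]′ (ascends-or-descends t))


lemma4p1 : (n : ℕ) → 2 ℕ.≤ n →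
    (w : List (Fin n)) → w ↭ allFin n →
    (as : List ℤ) → Linked _<_ as → as ↭ signing n w →
    (x : ℤ) → prodS n w x ≡ icyc (2 ℕ.* n) (+ 1) as x
lemma4p1 (suc (suc k)) _ w w↭ as sorted as↭ = Signing.agrees k w w↭ as sorted as↭
lemma4p1 (suc zero) (s≤s ())
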